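{- Let $A$ be an $n\times m$ binary matrix that is semi-canonical, with $r(A)=\langle x_1,\dots,x_n\rangle$ and $c(A)=\langle y_1,\dots,y_m\rangle$. Then there exist integers $s,t$ with $0\le s\le m$ and $0\le t\le n$ such that $x_1=2^s-1$ and $y_1=2^t-1$.
   Context: A binary matrix is a matrix with entries in $\{0,1\}$. For an $n\times m$ binary matrix $A=[a_{ij}]$, $r(A)=\langle x_1,\dots,x_n\rangle$ with $x_i=\sum_{j=1}^m a_{ij}2^{m-j}$ (the integer whose binary representation is row $i$, column 1 being the most significant bit), and $c(A)=\langle y_1,\dots,y_m\rangle$ with $y_j=\sum_{i=1}^n a_{ij}2^{n-i}$ (the integer whose binary representation is column $j$ read top to bottom). $A$ is semi-canonical if $x_1\le x_2\le\cdots\le x_n$ and $y_1\le\cdots\le y_m$. -}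

module Defs where

open import Data.Nat using (ℕ; zero; suc; _+_; _*_; _^_; _≤_)
open import Data.Fin using (Fin; zero; suc; toℕ; _<_)
open import Data.Bool using (Bool; true; false)
open import Data.Product using (_×_)

BinMatrix : ℕ → ℕ → Set
BinMatrix n m = Fin n → Fin m → Bool

bit : Bool → ℕ
bit true  = 1
bit false = 0

bin : (k : ℕ) → (Fin k → Bool) → ℕ
bin zero    b = 0
bin (suc k) b = bit (b zero) * 2 ^ k + bin k (λ j → b (suc j))

rowVal : ∀ {n m} → BinMatrix n m → Fin n → ℕ
rowVal {n} {m} a i = bin m (λ j → a i j)

colVal : ∀ {n m} → BinMatrix n m → Fin m → ℕ
colVal {n} {m} a j = bin n (λ i → a i j)

SemiCanonical : ∀ {n m} → BinMatrix n m → Set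
SemiCanonical {n} {m} a =
  (∀ (i i' : Fin n) → i < i' → rowVal a i ≤ rowVal a i') ×
  (∀ (j j' : Fin m) → j < j' → colVal a j ≤ colVal a j')

-- The first row of a semi-canonical matrix has the form 0…01…1: if a₁ⱼ = 1 and j < j',
-- then column j' is at least column j, whose leading (top) bit is 1, so the top bit a₁ⱼ'
-- of column j' is 1 as well. A bit string of that form has value 2^s − 1, s being the
-- number of ones. By symmetry the same holds for the first column.
module Submission where

open import Defs
open import Data.Nat using (ℕ; suc; _∸_; _^_; _≤_)
open import Data.Fin using (zero)
open import Data.Product using (Σ; _×_)
open import Relation.Binary.PropositionalEquality using (_≡_)

open import Data.Nat using (zero; _+_; _*_; _<_; z≤n; s≤s)
open import Data.Nat.Properties hiding (_≟_)
open import Data.Fin as Fin using (Fin; suc)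
open import Data.Bool using (Bool; true; false; _≟_)
open import Data.Bool.Properties using (¬-not)
open import Data.Product using (_,_)
open import Relation.Binary.PropositionalEquality using (refl; sym; cong; cong₂; module ≡-Reasoning)
open import Relation.Nullary using (yes; no; contradiction)

tail : ∀ {k} → (Fin (suc k) → Bool) → Fin k → Bool
tail b j = b (suc j)

UpwardClosed : ∀ {k} → (Fin k → Bool) → Set
UpwardClosed {k} b = ∀ (j j' : Fin k) → j Fin.< j' → b j ≡ true → b j' ≡ true

1*2^k+2^k≡2^[1+k] : ∀ k → 1 * 2 ^ k + 2 ^ k ≡ 2 ^ suc k
1*2^k+2^k≡2^[1+k] k = cong₂ _+_ (*-identityˡ (2 ^ k)) (sym (+-identityʳ (2 ^ k)))

bin<2^ : ∀ k b → bin k b < 2 ^ k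
bin<2^ zero    b = s≤s z≤n
bin<2^ (suc k) b = begin-strict
  bit (b zero) * 2 ^ k + bin k (tail b) <⟨ +-monoʳ-< (bit (b zero) * 2 ^ k) (bin<2^ k (tail b)) ⟩
  bit (b zero) * 2 ^ k + 2 ^ k          ≤⟨ +-monoˡ-≤ (2 ^ k) (*-monoˡ-≤ (2 ^ k) (bit≤1 (b zero))) ⟩
  1 * 2 ^ k + 2 ^ k                     ≡⟨ 1*2^k+2^k≡2^[1+k] k ⟩
  2 ^ suc k                             ∎
  where
  open ≤-Reasoning
  bit≤1 : ∀ x → bit x ≤ 1
  bit≤1 true  = s≤s z≤n
  bit≤1 false = z≤n

bin-leadingTrue : ∀ k b → b zero ≡ true → 2 ^ k ≤ bin (suc k) b
bin-leadingTrue k b b₀ rewrite b₀ = ≤-trans (≤-reflexive (sym (*-identityˡ (2 ^ k)))) (m≤m+n (1 * 2 ^ k) _)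

bin-leadingFalse : ∀ k b → b zero ≡ false → bin (suc k) b < 2 ^ k
bin-leadingFalse k b b₀ rewrite b₀ = bin<2^ k (tail b)

bin-leadingBit-mono : ∀ k b c → bin (suc k) b ≤ bin (suc k) c → b zero ≡ true → c zero ≡ true
bin-leadingBit-mono k b c b≤c b₀ with c zero ≟ true
... | yes c₀ = c₀
... | no  c₀ = contradiction (≤-trans (bin-leadingTrue k b b₀) b≤c) (<⇒≱ (bin-leadingFalse k c (¬-not c₀)))

m+1≡n⇒m≡n∸1 : ∀ {m n} → m + 1 ≡ n → m ≡ n ∸ 1
m+1≡n⇒m≡n∸1 {m} refl = sym (m+n∸n≡m m 1)

bin-allTrue : ∀ k b → (∀ j → b j ≡ true) → bin k b + 1 ≡ 2 ^ k
bin-allTrue zero    b all = refl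
bin-allTrue (suc k) b all rewrite all zero = begin
  1 * 2 ^ k + bin k (tail b) + 1   ≡⟨ +-assoc (1 * 2 ^ k) (bin k (tail b)) 1 ⟩
  1 * 2 ^ k + (bin k (tail b) + 1) ≡⟨ cong (1 * 2 ^ k +_) (bin-allTrue k (tail b) (λ j → all (suc j))) ⟩
  1 * 2 ^ k + 2 ^ k                ≡⟨ 1*2^k+2^k≡2^[1+k] k ⟩
  2 ^ suc k                        ∎
  where open ≡-Reasoning

bin-upwardClosed : ∀ k b → UpwardClosed b → Σ ℕ (λ s → s ≤ k × bin k b ≡ 2 ^ s ∸ 1)
bin-upwardClosed zero    b up = 0 , z≤n , refl
bin-upwardClosed (suc k) b up with b zero ≟ true
... | yes b₀ = suc k , ≤-refl , m+1≡n⇒m≡n∸1 (bin-allTrue (suc k) b all)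
  where
  all : ∀ j → b j ≡ true
  all zero    = b₀
  all (suc j) = up zero (suc j) (s≤s z≤n) b₀
... | no b₀ rewrite ¬-not b₀
  with bin-upwardClosed k (tail b) (λ j j' j<j' → up (suc j) (suc j') (s≤s j<j'))
... | s , s≤k , e = s , m≤n⇒m≤1+n s≤k , e

firstRow-upwardClosed : ∀ {n m} (a : BinMatrix (suc n) m) →
  (∀ j j' → j Fin.< j' → colVal a j ≤ colVal a j') → UpwardClosed (a zero)
firstRow-upwardClosed {n} a cols j j' j<j' =
  bin-leadingBit-mono n (λ i → a i j) (λ i → a i j') (cols j j' j<j')

firstColumn-upwardClosed : ∀ {n m} (a : BinMatrix n (suc m)) →
  (∀ i i' → i Fin.< i' → rowVal a i ≤ rowVal a i') → UpwardClosed (λ i → a i zero)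
firstColumn-upwardClosed {m = m} a rows i i' i<i' =
  bin-leadingBit-mono m (a i) (a i') (rows i i' i<i')

corollary1 : (n m : ℕ) → (a : BinMatrix (suc n) (suc m)) → SemiCanonical a →
    Σ ℕ (λ s → Σ ℕ (λ t → s ≤ suc m × t ≤ suc n ×
      rowVal a zero ≡ 2 ^ s ∸ 1 × colVal a zero ≡ 2 ^ t ∸ 1))
corollary1 n m a (rows , cols)
  with bin-upwardClosed (suc m) (a zero) (firstRow-upwardClosed a cols)
     | bin-upwardClosed (suc n) (λ i → a i zero) (firstColumn-upwardClosed a rows)
... | s , s≤ , x₁ | t , t≤ , y₁ = s , t , s≤ , t≤ , x₁ , y₁
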